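{- Let $k \ge 2$ be an even integer and let $D$ be a $k$-quasi-transitive digraph. If $v \in V(D)$ is a $(k+2)$-king of $D$ and $u \in V(D)$ satisfies $d(v,u) = k+2$, then $u$ is a $3$-king of $D$. Moreover, if $w \in V(D)$ satisfies $d(u,w) = 3$, then $d(v,w) = k+2$ and $w$ is also a $3$-king of $D$.
   Context: All digraphs are finite, without loops and without multiple arcs in the same direction; paths are directed. For $u,v \in V(D)$, $d(u,v)$ is the length of a shortest directed $uv$-path ($\infty$ if none, $d(v,v)=0$). A vertex $v$ is an $r$-king of $D$ if $d(v,u) \le r$ for every $u \in V(D)$. $D$ is $k$-quasi-transitive if for every directed path $(v_0, \dots, v_k)$ of length $k$, $(v_0,v_k) \in A(D)$ or $(v_k,v_0) \in A(D)$. -}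

module Defs where

open import Data.Nat using (ℕ; zero; suc; _+_; _≤_; _<_)
open import Data.Fin using (Fin)
open import Data.Vec using (Vec; []; _∷_; head; last)
open import Data.Vec.Relation.Unary.Unique.Propositional using (Unique)
open import Data.Product using (Σ; ∃; _×_; _,_)
open import Data.Sum using (_⊎_)
open import Relation.Nullary using (¬_)
open import Relation.Binary.PropositionalEquality using (_≡_)
open import Level using (0ℓ)

record Digraph : Set₁ where
  field
    n     : ℕ
    Arc   : Fin n → Fin n → Set
    loopless : ∀ x → ¬ Arc x x

Even : ℕ → Set
Even k = ∃ λ j → k ≡ j + j

module _ (D : Digraph) where
  open Digraph D

  data Walk : Fin n → Fin n → ℕ → Set where
    here : ∀ {x} → Walk x x zero
    step : ∀ {x y z m} → Arc x y → Walk y z m → Walk x z (suc m)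

  Chain : ∀ {m} → Vec (Fin n) m → Set
  Chain []            = Data.Unit.⊤ where import Data.Unit
  Chain (x ∷ [])      = Data.Unit.⊤ where import Data.Unit
  Chain (x ∷ y ∷ xs)  = Arc x y × Chain (y ∷ xs)

  IsPath : ∀ {m} → Vec (Fin n) (suc m) → Set
  IsPath vs = Unique vs × Chain vs

  DistLe : Fin n → Fin n → ℕ → Set
  DistLe x y r = ∃ λ m → m ≤ r × Walk x y m

  -- d(x,y) = r  (a shortest walk is a path, so this is the path distance)
  DistEq : Fin n → Fin n → ℕ → Set
  DistEq x y r = Walk x y r × (∀ m → m < r → ¬ Walk x y m)

  IsKing : ℕ → Fin n → Set
  IsKing r v = ∀ u → DistLe v u r

  QuasiTransitive : ℕ → Set
  QuasiTransitive k = ∀ (vs : Vec (Fin n) (suc k)) → IsPath vs →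
    Arc (head vs) (last vs) ⊎ Arc (last vs) (head vs)

-- Let P be a shortest v-u path, of length k + 2, and d its vertex at distance k from v.
-- Quasi-transitivity on the first k arcs of P gives d → v. Say that u dominates level m if
-- u → y for the end y of every path of length m starting at v. If u → c, where c is the
-- vertex of P at distance m + 2 from v, then for every such path Q the walk
-- u → c ⇝ d → v ⇝ y along P and Q is a path of length k (its vertices are separated by their
-- distances to v and to u), so quasi-transitivity gives u → y or y → u; the latter would
-- give a v-u walk of length at most k + 1. Hence level m + 2 implies level m. The paths
-- u → v ⇝ y give level k - 1, and level 1 gives level k through u → x ⇝ y for the second
-- vertex x. As k is even, descending from k - 1 reaches level 1 and descending from k
-- reaches all even levels, so u dominates every vertex within distance k of v. A walk of
-- length at most k + 2 from v then turns into one of length at most 3 from u, and a vertex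
-- at distance 3 from u cannot lie within distance k + 1 of v.

module Submission where

open import Defs
open import Data.Nat using (ℕ; zero; suc; _+_; _∸_; _≤_; _<_; z≤n; s≤s)
open import Data.Nat.Properties
open import Data.Nat.Tactic.RingSolver using (solve-∀)
open import Data.Fin using (Fin)
import Data.Fin.Properties as Fin
open import Data.Product using (Σ; ∃; _×_; _,_; proj₁; proj₂)
open import Data.Sum using (_⊎_; inj₁; inj₂; map₁)
open import Data.Empty using (⊥; ⊥-elim)
open import Data.Unit using (tt)
open import Data.Vec using (Vec; []; _∷_; head; last)
open import Data.Vec.Relation.Unary.All using (All; []; _∷_)
open import Data.Vec.Relation.Unary.Any using (Any; here; there)
open import Data.Vec.Relation.Unary.AllPairs using ([]; _∷_)
open import Data.Vec.Relation.Unary.Unique.Propositional using (Unique)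
open import Data.Vec.Membership.Propositional using (_∈_)
open import Function using (_∘_)
open import Level using (Level)
open import Relation.Nullary using (¬_; yes; no; contradiction)
open import Relation.Unary using (Pred)
open import Relation.Binary.PropositionalEquality using (_≡_; refl; sym; trans; cong; subst; subst₂)

module _ {a p : Level} {A : Set a} {P : Pred A p} where

  ¬Any⇒All¬ : ∀ {n} (xs : Vec A n) → ¬ Any P xs → All (¬_ ∘ P) xs
  ¬Any⇒All¬ []       _  = []
  ¬Any⇒All¬ (x ∷ xs) ¬p = (¬p ∘ here) ∷ ¬Any⇒All¬ xs (¬p ∘ there)

  All¬⇒¬Any : ∀ {n} {xs : Vec A n} → All (¬_ ∘ P) xs → ¬ Any P xs
  All¬⇒¬Any (¬px ∷ _)   (here px) = ¬px px
  All¬⇒¬Any (_   ∷ ¬ps) (there p) = All¬⇒¬Any ¬ps p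

DominatesBall : (D : Digraph) → Fin (Digraph.n D) → Fin (Digraph.n D) → ℕ → Set
DominatesBall D u v k = ∀ {y} → DistLe D v y k → Digraph.Arc D u y

even-or-odd : ∀ n → ∃ λ t → n ≡ t + t ⊎ n ≡ suc (t + t)
even-or-odd zero    = 0 , inj₁ refl
even-or-odd (suc n) with even-or-odd n
... | t , inj₁ n≡t+t   = t , inj₂ (cong suc n≡t+t)
... | t , inj₂ n≡1+t+t = suc t , inj₁ (trans (cong suc n≡1+t+t) (cong suc (sym (+-suc t t))))

module _ {D : Digraph} where
  open Digraph D
  open import Data.Vec.Membership.DecPropositional (Fin._≟_ {n}) using (_∈?_)

  private variable
    a b c y : Fin n
    i j l m : ℕ

  vertices : Walk D a b m → Vec (Fin n) (suc m)
  vertices (here {x}) = x ∷ []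
  vertices (step {x} _ w) = x ∷ vertices w

  IsSimple : Walk D a b m → Set
  IsSimple w = Unique (vertices w)

  step-simple : (e : Arc a b) (w : Walk D b c m) →
                ¬ a ∈ vertices w → IsSimple w → IsSimple (step e w)
  step-simple _ w a∉w w-simple = ¬Any⇒All¬ (vertices w) a∉w ∷ w-simple

  _++ʷ_ : Walk D a b i → Walk D b c j → Walk D a c (i + j)
  here     ++ʷ w' = w'
  step e w ++ʷ w' = step e (w ++ʷ w')

  end∈vertices : (w : Walk D a b m) → b ∈ vertices w
  end∈vertices here       = here refl
  end∈vertices (step _ w) = there (end∈vertices w)

  ∈-++ʷ⁻ : (w : Walk D a b i) (w' : Walk D b c j) →
           y ∈ vertices (w ++ʷ w') → y ∈ vertices w ⊎ y ∈ vertices w'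
  ∈-++ʷ⁻ here       w' y∈         = inj₂ y∈
  ∈-++ʷ⁻ (step _ w) w' (here refl) = inj₁ (here refl)
  ∈-++ʷ⁻ (step _ w) w' (there y∈) = map₁ there (∈-++ʷ⁻ w w' y∈)

  ++ʷ-simple : (w : Walk D a b i) (w' : Walk D b c j) → IsSimple w → IsSimple w' →
               (∀ {y} → y ∈ vertices w → y ∈ vertices w' → y ≡ b) → IsSimple (w ++ʷ w')
  ++ʷ-simple here             w' _             w'-simple _    = w'-simple
  ++ʷ-simple (step {a} e w) w' (a∉w ∷ w-simple) w'-simple meet =
    step-simple e (w ++ʷ w') a∉ (++ʷ-simple w w' w-simple w'-simple (meet ∘ there))
    where
    a∉ : ¬ a ∈ vertices (w ++ʷ w')
    a∉ a∈ with ∈-++ʷ⁻ w w' a∈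
    ... | inj₁ a∈w  = All¬⇒¬Any a∉w a∈w
    ... | inj₂ a∈w' =
      All¬⇒¬Any a∉w (subst (_∈ vertices w) (sym (meet (here refl) a∈w')) (end∈vertices w))

  prefix : (w : Walk D a b m) → y ∈ vertices w → DistLe D a y m
  prefix here       (here refl) = 0 , z≤n , here
  prefix (step _ w) (here refl) = 0 , z≤n , here
  prefix (step e w) (there y∈)  = let i , i≤m , p = prefix w y∈ in suc i , s≤s i≤m , step e p

  suffix : (w : Walk D a b m) → y ∈ vertices w → DistLe D y b m
  suffix here       (here refl) = 0 , z≤n , here
  suffix (step e w) (here refl) = _ , ≤-refl , step e w
  suffix (step _ w) (there y∈)  = let i , i≤m , s = suffix w y∈ in i , m≤n⇒m≤1+n i≤m , s

  suffix-simple : (w : Walk D a b m) (y∈ : y ∈ vertices w) →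
                  IsSimple w → IsSimple (proj₂ (proj₂ (suffix w y∈)))
  suffix-simple here       (here refl) w-simple       = w-simple
  suffix-simple (step e w) (here refl) w-simple       = w-simple
  suffix-simple (step _ w) (there y∈)  (_ ∷ w-simple) = suffix-simple w y∈ w-simple

  shortest⇒simple : (w : Walk D a b m) → (∀ l → l < m → ¬ Walk D a b l) → IsSimple w
  shortest⇒simple here       _        = [] ∷ []
  shortest⇒simple (step e w) shortest =
    step-simple e w a∉w (shortest⇒simple w λ l l<m w' → shortest (suc l) (s≤s l<m) (step e w'))
    where
    a∉w : ¬ _ ∈ vertices w
    a∉w a∈w = let i , i≤m , w' = suffix w a∈w in shortest i (s≤s i≤m) w'

  simplify : Walk D a b m → ∃ λ i → i ≤ m × Σ (Walk D a b i) IsSimple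
  simplify here = 0 , z≤n , here , [] ∷ []
  simplify {a = a} (step e w) with simplify w
  ... | i , i≤m , w' , w'-simple with a ∈? vertices w'
  ...   | yes a∈w' = let j , j≤i , s = suffix w' a∈w' in
                     j , m≤n⇒m≤1+n (≤-trans j≤i i≤m) , s , suffix-simple w' a∈w' w'-simple
  ...   | no  a∉w' = suc i , s≤s i≤m , step e w' , step-simple e w' a∉w' w'-simple

  splitAt : ∀ i {j} → i + j ≡ m → Walk D a b m → ∃ λ c → Walk D a c i × Walk D c b j
  splitAt zero    refl w          = _ , here , w
  splitAt (suc i) refl (step e w) = let c , p , s = splitAt i refl w in c , step e p , s

  distLe-trans : DistLe D a b i → DistLe D b c j → DistLe D a c (i + j)
  distLe-trans (i' , i'≤i , w) (j' , j'≤j , w') = i' + j' , +-mono-≤ i'≤i j'≤j , w ++ʷ w'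

  distLe⇒distEq : DistLe D a b m → (∀ l → l < m → ¬ Walk D a b l) → DistEq D a b m
  distLe⇒distEq (l , l≤m , w) shortest with m≤n⇒m<n∨m≡n l≤m
  ... | inj₁ l<m  = ⊥-elim (shortest l l<m w)
  ... | inj₂ refl = w , shortest

  head-vertices : (w : Walk D a b m) → head (vertices w) ≡ a
  head-vertices here       = refl
  head-vertices (step _ w) = refl

  last-vertices : (w : Walk D a b m) → last (vertices w) ≡ b
  last-vertices here                = refl
  last-vertices (step _ here)       = refl
  last-vertices (step _ (step e w)) = last-vertices (step e w)

  vertices-chain : (w : Walk D a b m) → Chain D (vertices w)
  vertices-chain here                = tt
  vertices-chain (step e here)       = e , tt
  vertices-chain (step e (step f w)) = e , vertices-chain (step f w)

  quasiTransitive-walk : ∀ {k} → QuasiTransitive D k → m ≡ k →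
                         (w : Walk D a b m) → IsSimple w → Arc a b ⊎ Arc b a
  quasiTransitive-walk qt refl w w-simple =
    subst₂ (λ a b → Arc a b ⊎ Arc b a) (head-vertices w) (last-vertices w)
           (qt (vertices w) (w-simple , vertices-chain w))

  dominatesBall⇒distLe : ∀ {u v k} r → DominatesBall D u v k →
                         DistLe D v y (k + r) → DistLe D u y (suc r)
  dominatesBall⇒distLe {k = k} r dom (l , l≤k+r , w) with ≤-total l k
  ... | inj₁ l≤k = 1 , s≤s z≤n , step (dom (l , l≤k , w)) here
  ... | inj₂ k≤l =
    let s , k+s≡l = m≤n⇒∃[o]m+o≡n k≤l
        _ , p , q = splitAt k k+s≡l w
    in suc s , s≤s (+-cancelˡ-≤ k s r (subst (_≤ k + r) (sym k+s≡l) l≤k+r)) ,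
       step (dom (k , ≤-refl , p)) q

  dominatesBall⇒king : ∀ {u v k} r → DominatesBall D u v k →
                       IsKing D (k + r) v → IsKing D (suc r) u
  dominatesBall⇒king r dom king y = dominatesBall⇒distLe r dom (king y)

module FarthestVertex {D : Digraph} {k : ℕ} (2≤k : 2 ≤ k) (qt : QuasiTransitive D k)
                      {v u : Fin (Digraph.n D)} (v⇝u : DistEq D v u (k + 2)) where
  open Digraph D

  private variable
    a b c y : Fin n
    i j l m : ℕ

  no-shortcut : DistLe D v u l → l < k + 2 → ⊥
  no-shortcut (l' , l'≤l , w) l<k+2 = proj₂ v⇝u l' (≤-<-trans l'≤l l<k+2) w

  within-k : l ≤ k → l < k + 2
  within-k l≤k = ≤-<-trans l≤k (m<m+n k (s≤s z≤n))

  three<k+2 : 3 < k + 2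
  three<k+2 = +-monoˡ-≤ 2 2≤k

  inner-simple : Walk D v a i → (w : Walk D a b j) → Walk D b u l →
                 i + j + l ≡ k + 2 → IsSimple w
  inner-simple {i = i} {l = l} p w s eq = shortest⇒simple w λ j' j'<j w' →
    proj₂ v⇝u _ (subst (i + j' + l <_) eq (+-monoˡ-< l (+-monoʳ-< i j'<j))) ((p ++ʷ w') ++ʷ s)

  d : Fin n
  d = proj₁ (splitAt k refl (proj₁ v⇝u))

  v⇝d : Walk D v d k
  v⇝d = proj₁ (proj₂ (splitAt k refl (proj₁ v⇝u)))

  d⇝u : Walk D d u 2
  d⇝u = proj₂ (proj₂ (splitAt k refl (proj₁ v⇝u)))

  d→v : Arc d v
  d→v with quasiTransitive-walk qt refl v⇝d (inner-simple here v⇝d d⇝u refl)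
  ... | inj₁ v→d = ⊥-elim (proj₂ v⇝u 3 three<k+2 (step v→d d⇝u))
  ... | inj₂ d→v = d→v

  cut : ∀ m → 2 + m ≤ k →
        ∃ λ c → ∃ λ j → 2 + m + j ≡ k × Walk D v c (2 + m) × Walk D c d j
  cut m 2+m≤k =
    let j , eq = m≤n⇒∃[o]m+o≡n 2+m≤k
        c , p , q = splitAt (2 + m) eq v⇝d
    in c , j , eq , p , q

  cut-length : 2 + m + j ≡ k → 2 + m + (j + 2) ≡ k + 2
  cut-length {m} {j} eq = trans (sym (+-assoc (2 + m) j 2)) (cong (_+ 2) eq)

  Dominated : ℕ → Set
  Dominated m = ∀ {y} (r : Walk D v y m) → IsSimple r → Arc u y

  closing-arc : (t : Walk D u y l) → l ≡ k → IsSimple t → Walk D v y i → i ≤ k → Arc u y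
  closing-arc t l≡k t-simple r i≤k with quasiTransitive-walk qt l≡k t t-simple
  ... | inj₁ u→y = u→y
  ... | inj₂ y→u = ⊥-elim (proj₂ v⇝u _ (+-mono-≤-< i≤k ≤-refl) (r ++ʷ step y→u here))

  dominated-from-cut : (p : Walk D v c (2 + m)) (q : Walk D c d j) →
                       2 + m + j ≡ k → Arc u c → Dominated m
  dominated-from-cut {m = m} {j = j} p q eq u→c {y} r r-simple =
    closing-arc t (trans (length-eq m j) eq) t-simple r m≤k
    where
    length-eq : ∀ m j → suc (j + suc m) ≡ 2 + m + j
    length-eq = solve-∀

    m≤k : m ≤ k
    m≤k = ≤-trans (≤-trans (m≤n+m m 2) (m≤m+n (2 + m) j)) (≤-reflexive eq)

    q∩r : ∀ {x} → x ∈ vertices q → x ∈ vertices r → ⊥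
    q∩r x∈q x∈r =
      no-shortcut (distLe-trans (prefix r x∈r) (distLe-trans (suffix q x∈q) (2 , ≤-refl , d⇝u)))
      (within-k (≤-reflexive (trans (detour-length m j) eq)))
      where
      detour-length : ∀ m j → m + (j + 2) ≡ 2 + m + j
      detour-length = solve-∀

    u∉q : ¬ u ∈ vertices q
    u∉q u∈q =
      no-shortcut (distLe-trans (2 + m , ≤-refl , p) (prefix q u∈q)) (within-k (≤-reflexive eq))

    u∉rest : ¬ u ∈ vertices (q ++ʷ step d→v r)
    u∉rest u∈ with ∈-++ʷ⁻ q (step d→v r) u∈
    ... | inj₁ u∈q         = u∉q u∈q
    ... | inj₂ (here u≡d)  = u∉q (subst (_∈ vertices q) (sym u≡d) (end∈vertices q))
    ... | inj₂ (there u∈r) = no-shortcut (prefix r u∈r) (within-k m≤k)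

    rest-simple : IsSimple (q ++ʷ step d→v r)
    rest-simple = ++ʷ-simple q (step d→v r) (inner-simple p q d⇝u (cong (_+ 2) eq))
      (step-simple d→v r (q∩r (end∈vertices q)) r-simple) meet
      where
      meet : ∀ {x} → x ∈ vertices q → x ∈ vertices (step d→v r) → x ≡ d
      meet _   (here x≡d)  = x≡d
      meet x∈q (there x∈r) = ⊥-elim (q∩r x∈q x∈r)

    t : Walk D u y (suc (j + suc m))
    t = step u→c (q ++ʷ step d→v r)

    t-simple : IsSimple t
    t-simple = step-simple u→c _ u∉rest rest-simple

  u→v : Arc u v
  u→v with cut 0 2≤k
  ... | c , j , eq , p , q = dominated-from-cut p q eq u→c here ([] ∷ [])
    where
    c⇝u-simple : IsSimple (q ++ʷ d⇝u)
    c⇝u-simple = inner-simple p (q ++ʷ d⇝u) here (trans (+-identityʳ _) (cut-length {0} {j} eq))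

    u→c : Arc u c
    u→c with quasiTransitive-walk qt (trans (+-comm j 2) eq) (q ++ʷ d⇝u) c⇝u-simple
    ... | inj₁ c→u = ⊥-elim (proj₂ v⇝u 3 three<k+2 (p ++ʷ step c→u here))
    ... | inj₂ u→c = u→c

  dominated-2+ : 2 + m ≤ k → Dominated (2 + m) → Dominated m
  dominated-2+ {m} 2+m≤k dom with cut m 2+m≤k
  ... | c , j , eq , p , q =
    dominated-from-cut p q eq (dom p (inner-simple here p (q ++ʷ d⇝u) (cut-length {m} {j} eq)))

  dominated-at-pred-k : suc l ≡ k → Dominated l
  dominated-at-pred-k {l} eq r r-simple =
    closing-arc (step u→v r) eq (step-simple u→v r u∉r r-simple) r l≤k
    where
    l≤k : l ≤ k
    l≤k = ≤-trans (n≤1+n l) (≤-reflexive eq)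

    u∉r : ¬ u ∈ vertices r
    u∉r u∈r = no-shortcut (prefix r u∈r) (within-k l≤k)

  dominated-at-k : Dominated 1 → l ≡ k → Dominated l
  dominated-at-k _    0≡k here         _ = contradiction (subst (2 ≤_) (sym 0≡k) 2≤k) λ ()
  dominated-at-k dom₁ eq (step {y = x} v→x r) (_ ∷ r-simple) =
    closing-arc (step u→x r) eq (step-simple u→x r u∉r r-simple) (step v→x r) (≤-reflexive eq)
    where
    u→x : Arc u x
    u→x = dom₁ (step v→x here) ((v≢x ∷ []) ∷ [] ∷ [])
      where
      v≢x : ¬ v ≡ x
      v≢x v≡x = loopless v (subst (Arc v) (sym v≡x) v→x)

    u∉r : ¬ u ∈ vertices r
    u∉r u∈r = no-shortcut (prefix (step v→x r) (there u∈r)) (within-k (≤-reflexive eq))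

  descend : ∀ t → t + t + m ≤ k → Dominated (t + t + m) → Dominated m
  descend zero    _  dom = dom
  descend {m} (suc t) le dom =
    dominated-2+ (≤-trans (m≤n+m (2 + m) (t + t)) le')
                 (descend t le' (subst Dominated (regroup t m) dom))
    where
    regroup : ∀ t m → suc t + suc t + m ≡ t + t + (2 + m)
    regroup = solve-∀
    le' : t + t + (2 + m) ≤ k
    le' = subst (_≤ k) (regroup t m) le

  dominated-odd-gap : ∀ t → suc (t + t + m) ≡ k → Dominated m
  dominated-odd-gap t eq = descend t (≤-trans (n≤1+n _) (≤-reflexive eq)) (dominated-at-pred-k eq)

  dominated-1 : Even k → Dominated 1
  dominated-1 (zero  , k≡0)   = contradiction (subst (2 ≤_) k≡0 2≤k) λ ()
  dominated-1 (suc h , k≡h+h) = dominated-odd-gap h (trans (odd-pred h) (sym k≡h+h))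
    where
    odd-pred : ∀ h → suc (h + h + 1) ≡ suc h + suc h
    odd-pred = solve-∀

  dominated-≤k : Even k → ∀ m → m ≤ k → Dominated m
  dominated-≤k ev m m≤k with even-or-odd (k ∸ m)
  ... | t , inj₁ gap≡t+t = descend t (≤-reflexive gap) (dominated-at-k (dominated-1 ev) gap)
    where
    gap : t + t + m ≡ k
    gap = trans (cong (_+ m) (sym gap≡t+t)) (m∸n+n≡m m≤k)
  ... | t , inj₂ gap≡1+t+t =
    dominated-odd-gap t (trans (cong (_+ m) (sym gap≡1+t+t)) (m∸n+n≡m m≤k))

  ball-dominated : Even k → DominatesBall D u v k
  ball-dominated ev (l , l≤k , w) =
    let i , i≤l , s , s-simple = simplify w in dominated-≤k ev i (≤-trans i≤l l≤k) s s-simple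

mainTheorem6 : (k : ℕ) → 2 ≤ k → Even k →
    (D : Digraph) → QuasiTransitive D k →
    (v u : Fin (Digraph.n D)) → IsKing D (k + 2) v → DistEq D v u (k + 2) →
    IsKing D 3 u ×
    (∀ (w : Fin (Digraph.n D)) → DistEq D u w 3 →
      DistEq D v w (k + 2) × IsKing D 3 w)
mainTheorem6 k 2≤k ev D qt v u king v⇝u =
  king-at v⇝u , λ w u⇝w → at-distance-k+2 w u⇝w , king-at (at-distance-k+2 w u⇝w)
  where
  dominates : ∀ {x} → DistEq D v x (k + 2) → DominatesBall D x v k
  dominates v⇝x = FarthestVertex.ball-dominated 2≤k qt v⇝x ev

  king-at : ∀ {x} → DistEq D v x (k + 2) → IsKing D 3 x
  king-at v⇝x = dominatesBall⇒king 2 (dominates v⇝x) king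

  at-distance-k+2 : ∀ w → DistEq D u w 3 → DistEq D v w (k + 2)
  at-distance-k+2 w u⇝w = distLe⇒distEq (king w) λ l l<k+2 p →
    let l≤k+1 = ≤-pred (subst (suc l ≤_) (+-suc k 1) l<k+2)
        i , i≤2 , q = dominatesBall⇒distLe 1 (dominates v⇝u) (l , l≤k+1 , p)
    in proj₂ u⇝w i (s≤s i≤2) q
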